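{- Let the functions $K,K',R,F_0,F_1,F_2,F_3$ on pairs of positive integers be defined as below. Then for all positive integers $s,t$ with $t>s$, \[ 1<\frac{F_0(s,t)}{tK(s,t)}<\frac{F_3(s,t)}{tK(s,t)}<72, \qquad \frac{3s}{2}<\frac{F_1(s,t)}{tK(s,t)}<\frac{F_2(s,t)}{tK(s,t)}<158s. \]
   Context: For positive integers $s,t$: $K(1,t)=2$, $K'(1,t)=5$; $K(s,1)=2^s$, $K'(s,1)=2^s+3$; and for $s,t>1$, $K(s,t)=K(s,t-1)\,K(s-1,K'(s,t-1))$, $K'(s,t)=K'(s,t-1)\,K(s-1,K'(s,t-1))+K'(s-1,K'(s,t-1))$. $R(1,t)=0$, $R(s,1)=0$, and $R(s,t)=2K(s-1,K'(s,t-1))+R(s-1,K'(s,t-1))$ for $s,t>1$. Writing $F(s,t)=(F_0,F_1,F_2,F_3)(s,t)$: $F(1,t)=(2t+7,\,10t+15,\,16t+12,\,8t+4)$ for $t>1$; $F(s,1)=(2^{s+1}+5,\,3\cdot2^{s+1}+9,\,2^{s+3}+8,\,2^{s+2}+4)$ for all $s$; and for $s,t>1$, with $k=K(s-1,K'(s,t-1))$ and $m=K'(s,t-1)$, $F_0(s,t)=k[F_0(s,t-1)+R(s,t-1)-2]+F_0(s-1,m)$, $F_1(s,t)=k[F_1(s,t-1)+3K'(s,t-1)+3R(s,t-1)-4]+F_1(s-1,m)$, $F_2(s,t)=k[F_2(s,t-1)+3K'(s,t-1)+4R(s,t-1)+1]+F_2(s-1,m)$, $F_3(s,t)=k[F_3(s,t-1)+2R(s,t-1)+3]+F_3(s-1,m)$.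 -}

module Defs where

open import Data.Nat using (ℕ; zero; suc; _+_; _*_; _∸_; _^_)

record Vals : Set where
  constructor vals
  field
    K  : ℕ
    K' : ℕ
    R  : ℕ
    F0 : ℕ
    F1 : ℕ
    F2 : ℕ
    F3 : ℕ
open Vals public

junk : Vals
junk = vals 0 0 0 0 0 0 0

-- values at (s,1), for every s ≥ 1
base : ℕ → Vals
base s = vals (2 ^ s) (2 ^ s + 3) 0
              (2 ^ suc s + 5) (3 * 2 ^ suc s + 9) (2 ^ (s + 3) + 8) (2 ^ (s + 2) + 4)

level1 : ℕ → Vals
level1 zero = junk
level1 (suc zero) = base 1
level1 t@(suc (suc _)) =
  vals 2 5 0 (2 * t + 7) (10 * t + 15) (16 * t + 12) (8 * t + 4)

-- values at (s,t), t > 1, from p = values at (s,t-1) and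
-- q = values at (s-1, K'(s,t-1))
combine : Vals → Vals → Vals
combine p q =
  vals (K p * k)
       (K' p * k + K' q)
       (2 * k + R q)
       (k * (F0 p + R p ∸ 2) + F0 q)
       (k * (F1 p + 3 * K' p + 3 * R p ∸ 4) + F1 q)
       (k * (F2 p + 3 * K' p + 4 * R p + 1) + F2 q)
       (k * (F3 p + 2 * R p + 3) + F3 q)
  where k = K q

-- level s (given as the actual s ≥ 2), from the function for level s-1
levelUp : ℕ → (ℕ → Vals) → ℕ → Vals
levelUp s prev zero = junk
levelUp s prev (suc zero) = base s
levelUp s prev (suc (suc t)) =
  let p = levelUp s prev (suc t) in combine p (prev (K' p))

-- G s t = all values at (s,t) for positive integers s,t (junk if s or t is 0)
G : ℕ → ℕ → Vals
G zero t = junk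
G (suc zero) t = level1 t
G (suc (suc s)) t = levelUp (suc (suc s)) (G (suc s)) t

Kf K'f Rf F₀ F₁ F₂ F₃ : ℕ → ℕ → ℕ
Kf  s t = K  (G s t)
K'f s t = K' (G s t)
Rf  s t = R  (G s t)
F₀  s t = F0 (G s t)
F₁  s t = F1 (G s t)
F₂  s t = F2 (G s t)
F₃  s t = F3 (G s t)

-- The lower bounds and F₀ < F₃, F₁ < F₂ come from invariants
-- holding uniformly in s (K ≥ 2^s, K' ≥ K + 3, 2^s R ≤ 3K).  For the upper bounds,
-- F ∈ {F₂, F₃} satisfies F(combine p q) = K q · (F p + ΔF p) + F q, so a bound
-- F ≤ c' · tK on level s − 1 yields F ≤ c · tK on level s once ΔF + c' K' ≤ c K there.
-- Levels 1–3 are handled with explicit constants (c = 6, 20, 36 for F₃ and 14, 54,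
-- 102 for F₂).  From level 4 on, the sharper estimate K' ≤ (1 + 5/2^s) K − 2 lets
-- F₃ ≤ (72 − 369/2^s) tK and F₂ ≤ (158 s − 2) tK propagate from each level to the next.
module Submission where

open import Defs
open import Data.Nat using (ℕ; _+_; _*_; _<_; _≤_)
open import Data.Product using (_×_)
open import Data.Nat using (zero; suc; _∸_; _^_; z≤n; s≤s; _≤?_; NonZero; >-nonZero)
open import Data.Nat.Properties
open import Data.Nat.Tactic.RingSolver using (solve; solve-∀)
open import Data.List using (_∷_; [])
open import Data.Product using (_,_)
open import Function using (_$_)
open import Relation.Binary.PropositionalEquality using (_≡_; refl; sym; trans; cong; subst)
open import Relation.Nullary.Decidable using (True; toWitness)

open ≤-Reasoning

≤-decide : ∀ {m n} {m≤n : True (m ≤? n)} → m ≤ n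
≤-decide {m≤n = m≤n} = toWitness m≤n

m+k≡n⇒m≤n : ∀ {m n} k → m + k ≡ n → m ≤ n
m+k≡n⇒m≤n {m} k refl = m≤m+n m k

infixl 6 _⊕_
_⊕_ : ∀ {a b c d} → a ≤ b → c ≤ d → a + c ≤ b + d
_⊕_ = +-mono-≤

16≤2^[4+n] : ∀ n → 16 ≤ 2 ^ (4 + n)
16≤2^[4+n] n = ^-monoʳ-≤ 2 (m≤m+n 4 n)

F₂-base : ∀ s → F2 (base s) ≡ 8 * 2 ^ s + 8
F₂-base s = cong (_+ 8) (trans (^-distribˡ-+-* 2 s 3) (*-comm (2 ^ s) 8))

F₃-base : ∀ s → F3 (base s) ≡ 4 * 2 ^ s + 4
F₃-base s = cong (_+ 4) (trans (^-distribˡ-+-* 2 s 2) (*-comm (2 ^ s) 4))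

-- Uniform invariants

record Invariant (s t : ℕ) (v : Vals) : Set where
  field
    2^s≤K    : 2 ^ s ≤ K v
    K+3≤K'   : K v + 3 ≤ K' v
    2^s*R≤3K : 2 ^ s * R v ≤ 3 * K v
    R≤K      : R v ≤ K v
    tK<F₀    : t * K v < F0 v
    F₀<F₃    : F0 v < F3 v
    F₁<F₂    : F1 v < F2 v
    -- 3(s + 1)(t − 1) K < 2 F₁, the form that survives `combine`; it gives
    -- 3s · tK < 2F₁ as soon as t > s.
    F₁-lower : 3 * suc s * (t * K v) < 2 * F1 v + 3 * suc s * K v
open Invariant

K-positive : ∀ {s t v} → Invariant s t v → 1 ≤ K v
K-positive {s} I = ≤-trans (m^n>0 2 s) (2^s≤K I)

K'-positive : ∀ {s t v} → Invariant s t v → 1 ≤ K' v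
K'-positive {v = v} I = ≤-trans (≤-trans (s≤s z≤n) (m≤n+m 3 (K v))) (K+3≤K' I)

invariant-base : ∀ s → Invariant s 1 (base s)
invariant-base s = record
  { 2^s≤K    = ≤-refl
  ; K+3≤K'   = ≤-refl
  ; 2^s*R≤3K = ≤-trans (≤-reflexive (*-zeroʳ (2 ^ s))) z≤n
  ; R≤K      = z≤n
  ; tK<F₀    = tK<F₀-base (2 ^ s)
  ; F₀<F₃    = subst (2 * 2 ^ s + 5 <_) (sym (F₃-base s)) (F₀<F₃-base (m^n>0 2 s))
  ; F₁<F₂    = subst (3 * (2 * 2 ^ s) + 9 <_) (sym (F₂-base s)) (F₁<F₂-base (m^n>0 2 s))
  ; F₁-lower = F₁-lower-base (2 ^ s)
  }
  where
  tK<F₀-base : ∀ u → 1 * u < 2 * u + 5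
  tK<F₀-base u = m+k≡n⇒m≤n (u + 4) (solve (u ∷ []))
  F₀<F₃-base : ∀ {u} → 1 ≤ u → 2 * u + 5 < 4 * u + 4
  F₀<F₃-base {suc w} _ = m+k≡n⇒m≤n (2 * w) (solve (w ∷ []))
  F₁<F₂-base : ∀ {u} → 1 ≤ u → 3 * (2 * u) + 9 < 8 * u + 8
  F₁<F₂-base {suc w} _ = m+k≡n⇒m≤n (2 * w) (solve (w ∷ []))
  F₁-lower-base : ∀ u → 3 * suc s * (1 * u) < 2 * (3 * (2 * u) + 9) + 3 * suc s * u
  F₁-lower-base u = m+k≡n⇒m≤n (12 * u + 17) (solve (s ∷ u ∷ []))

invariant-level₁ : ∀ t → Invariant 1 (2 + t) (G 1 (2 + t))
invariant-level₁ t = record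
  { 2^s≤K    = ≤-refl
  ; K+3≤K'   = ≤-refl
  ; 2^s*R≤3K = z≤n
  ; R≤K      = z≤n
  ; tK<F₀    = m+k≡n⇒m≤n 6 tK<F₀-slack
  ; F₀<F₃    = m+k≡n⇒m≤n (6 * t + 8) F₀<F₃-slack
  ; F₁<F₂    = m+k≡n⇒m≤n (6 * t + 8) F₁<F₂-slack
  ; F₁-lower = m+k≡n⇒m≤n (8 * t + 57) F₁-lower-slack
  }
  where
  tK<F₀-slack : suc ((2 + t) * 2) + 6 ≡ 2 * (2 + t) + 7
  tK<F₀-slack = solve (t ∷ [])
  F₀<F₃-slack : suc (2 * (2 + t) + 7) + (6 * t + 8) ≡ 8 * (2 + t) + 4
  F₀<F₃-slack = solve (t ∷ [])
  F₁<F₂-slack : suc (10 * (2 + t) + 15) + (6 * t + 8) ≡ 16 * (2 + t) + 12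
  F₁<F₂-slack = solve (t ∷ [])
  F₁-lower-slack : suc (3 * 2 * ((2 + t) * 2)) + (8 * t + 57) ≡ 2 * (10 * (2 + t) + 15) + 3 * 2 * 2
  F₁-lower-slack = solve (t ∷ [])

R-combine-bound : ∀ {u k r Kp} → r ≤ k → u ≤ Kp → u * (2 * k + r) ≤ 3 * (Kp * k)
R-combine-bound {u} {k} {r} {Kp} r≤k u≤Kp = begin
  u * (2 * k + r)  ≤⟨ *-monoʳ-≤ u (+-monoʳ-≤ (2 * k) r≤k) ⟩
  u * (2 * k + k)  ≡⟨ solve (u ∷ k ∷ []) ⟩
  3 * (u * k)      ≤⟨ *-monoʳ-≤ 3 (*-monoˡ-≤ k u≤Kp) ⟩
  3 * (Kp * k)     ∎

R≤K-from-scaled : ∀ {u r K} → 4 ≤ u → u * r ≤ 3 * K → r ≤ K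
R≤K-from-scaled {u} {r} {K} 4≤u u*r≤3K = *-cancelˡ-≤ 4 $ begin
  4 * r  ≤⟨ *-monoˡ-≤ r 4≤u ⟩
  u * r  ≤⟨ u*r≤3K ⟩
  3 * K  ≤⟨ *-monoˡ-≤ K {3} {4} ≤-decide ⟩
  4 * K  ∎

tK<F₀-step : ∀ t Kp Yp F d k Fq → t * Kp < F → F ≤ 2 + d → Kp + 3 ≤ Yp → Yp * k < Fq
           → suc t * (Kp * k) < k * d + Fq
tK<F₀-step t Kp Yp F d k Fq tKp<F F≤2+d Kp+3≤Yp Yp*k<Fq =
  +-cancelʳ-≤ (4 * k) _ _ $ begin
    suc (suc t * (Kp * k)) + 4 * k
      ≡⟨ solve (t ∷ Kp ∷ k ∷ []) ⟩
    k * suc (t * Kp) + suc ((Kp + 3) * k)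
      ≤⟨ *-monoʳ-≤ k (≤-trans tKp<F F≤2+d) ⊕ ≤-trans (s≤s (*-monoˡ-≤ k Kp+3≤Yp)) Yp*k<Fq ⟩
    k * (2 + d) + Fq
      ≤⟨ m+k≡n⇒m≤n (2 * k) (solve (d ∷ k ∷ Fq ∷ [])) ⟩
    k * d + Fq + 4 * k
      ∎

increment-F₀≤F₃ : ∀ {a b} r → a ≤ b → a + r ∸ 2 ≤ b + 2 * r + 3
increment-F₀≤F₃ {a} {b} r a≤b = begin
  a + r ∸ 2       ≤⟨ m∸n≤m (a + r) 2 ⟩
  a + r           ≤⟨ +-monoˡ-≤ r a≤b ⟩
  b + r           ≤⟨ m+k≡n⇒m≤n (r + 3) (solve (b ∷ r ∷ [])) ⟩
  b + 2 * r + 3   ∎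

increment-F₁≤F₂ : ∀ {a b} y r → a ≤ b → a + 3 * y + 3 * r ∸ 4 ≤ b + 3 * y + 4 * r + 1
increment-F₁≤F₂ {a} {b} y r a≤b = begin
  a + 3 * y + 3 * r ∸ 4      ≤⟨ m∸n≤m (a + 3 * y + 3 * r) 4 ⟩
  a + 3 * y + 3 * r          ≤⟨ +-monoˡ-≤ (3 * r) (+-monoˡ-≤ (3 * y) a≤b) ⟩
  b + 3 * y + 3 * r          ≤⟨ m+k≡n⇒m≤n (r + 1) (solve (b ∷ y ∷ r ∷ [])) ⟩
  b + 3 * y + 4 * r + 1      ∎

F₁-lower-step : ∀ n t Kp Yp Rp F k Fq e
  → F + 3 * Yp + 3 * Rp ≤ 4 + e
  → 3 * suc n * (suc t * Kp) < 2 * F + 3 * suc n * Kp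
  → 3 * n * (Yp * k) < 2 * Fq + 3 * n * k
  → Kp + 3 ≤ Yp
  → 3 * suc n * (suc (suc t) * (Kp * k)) < 2 * (k * e + Fq) + 3 * suc n * (Kp * k)
F₁-lower-step n t Kp Yp Rp F k Fq e F≤4+e ih-p ih-q Kp+3≤Yp =
  +-cancelʳ-≤ (2 * k * F + (3 * n + 6) * k * Yp + 6 * k * Rp + 3 * Kp * k + (9 * n + 19) * k) _ _ $
  begin
    suc (3 * suc n * (suc (suc t) * (Kp * k)))
      + (2 * k * F + (3 * n + 6) * k * Yp + 6 * k * Rp + 3 * Kp * k + (9 * n + 19) * k)
      ≡⟨ solve (n ∷ t ∷ Kp ∷ Yp ∷ Rp ∷ F ∷ k ∷ []) ⟩
    k * suc (3 * suc n * (suc t * Kp)) + 2 * k * (F + 3 * Yp + 3 * Rp)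
      + suc (3 * n * (Yp * k)) + (3 * n + 6) * k * (Kp + 3)
      ≤⟨ *-monoʳ-≤ k ih-p ⊕ *-monoʳ-≤ (2 * k) F≤4+e ⊕ ih-q
           ⊕ *-monoʳ-≤ ((3 * n + 6) * k) Kp+3≤Yp ⟩
    k * (2 * F + 3 * suc n * Kp) + 2 * k * (4 + e) + (2 * Fq + 3 * n * k) + (3 * n + 6) * k * Yp
      ≤⟨ m+k≡n⇒m≤n (6 * k * Rp + 3 * Kp * k + (6 * n + 11) * k)
           (solve (n ∷ Kp ∷ Yp ∷ Rp ∷ F ∷ k ∷ Fq ∷ e ∷ [])) ⟩
    2 * (k * e + Fq) + 3 * suc n * (Kp * k)
      + (2 * k * F + (3 * n + 6) * k * Yp + 6 * k * Rp + 3 * Kp * k + (9 * n + 19) * k)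
      ∎

invariant-step : ∀ {s t p q} → Invariant (2 + s) (suc t) p → Invariant (suc s) (K' p) q
               → Invariant (2 + s) (2 + t) (combine p q)
invariant-step {s} {t} {p} {q} Ip Iq = record
  { 2^s≤K    = ≤-trans (2^s≤K Ip) (m≤m*n (K p) k {{>-nonZero (K-positive Iq)}})
  ; K+3≤K'   = *-monoˡ-≤ k (≤-trans (m≤m+n (K p) 3) (K+3≤K' Ip))
               ⊕ ≤-trans (m≤n+m 3 k) (K+3≤K' Iq)
  ; 2^s*R≤3K = 2^s*R≤3K-new
  ; R≤K      = R≤K-from-scaled (^-monoʳ-≤ 2 (m≤m+n 2 s)) 2^s*R≤3K-new
  ; tK<F₀    = tK<F₀-step (suc t) (K p) (K' p) (F0 p) (F0 p + R p ∸ 2) k (F0 q) (tK<F₀ Ip)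
                 (≤-trans (m≤m+n (F0 p) (R p)) (m≤n+m∸n (F0 p + R p) 2)) (K+3≤K' Ip) (tK<F₀ Iq)
  ; F₀<F₃    = +-mono-≤-< (*-monoʳ-≤ k (increment-F₀≤F₃ (R p) (<⇒≤ (F₀<F₃ Ip))))
                          (F₀<F₃ Iq)
  ; F₁<F₂    = +-mono-≤-< (*-monoʳ-≤ k (increment-F₁≤F₂ (K' p) (R p) (<⇒≤ (F₁<F₂ Ip))))
                          (F₁<F₂ Iq)
  ; F₁-lower = F₁-lower-step (2 + s) t (K p) (K' p) (R p) (F1 p) k (F1 q)
                 (F1 p + 3 * K' p + 3 * R p ∸ 4)
                 (m≤n+m∸n _ 4) (F₁-lower Ip) (F₁-lower Iq) (K+3≤K' Ip)
  }
  where
  k = K q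
  2^s*R≤3K-new : 2 ^ (2 + s) * (2 * k + R q) ≤ 3 * (K p * k)
  2^s*R≤3K-new = R-combine-bound (R≤K Iq) (2^s≤K Ip)

invariant : ∀ s t → 1 ≤ t → Invariant (suc s) t (G (suc s) t)
invariant zero    (suc zero)    _ = invariant-base 1
invariant zero    (suc (suc t)) _ = invariant-level₁ t
invariant (suc s) (suc zero)    _ = invariant-base (2 + s)
invariant (suc s) (suc (suc t)) _ = step (invariant (suc s) (suc t) (s≤s z≤n))
  where
  step : Invariant (2 + s) (suc t) (G (2 + s) (suc t)) → Invariant (2 + s) (2 + t) (G (2 + s) (2 + t))
  step Ip = invariant-step Ip (invariant s (K' (G (2 + s) (suc t))) (K'-positive Ip))

K≤K' : ∀ s t → 1 ≤ t → Kf (suc s) t ≤ K'f (suc s) t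
K≤K' s t 1≤t = ≤-trans (m≤m+n _ 3) (K+3≤K' (invariant s t 1≤t))

F₁-lower-bound : ∀ s t → suc s < t → 3 * suc s * (t * Kf (suc s) t) < 2 * F₁ (suc s) t
F₁-lower-bound s t s<t =
  drop-offset (suc s) t (Kf (suc s) t) (F₁ (suc s) t) s<t
    (F₁-lower (invariant s t (≤-trans (s≤s z≤n) s<t)))
  where
  drop-offset : ∀ s t K F → s < t
              → 3 * suc s * (t * K) < 2 * F + 3 * suc s * K → 3 * s * (t * K) < 2 * F
  drop-offset s t K F s<t lower = +-cancelʳ-≤ (3 * suc s * K) _ _ $ begin
    suc (3 * s * (t * K)) + 3 * suc s * K
      ≡⟨ solve (s ∷ t ∷ K ∷ []) ⟩
    suc (3 * s * (t * K) + 3 * (suc s * K))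
      ≤⟨ s≤s (+-monoʳ-≤ (3 * s * (t * K)) (*-monoʳ-≤ 3 (*-monoˡ-≤ K s<t))) ⟩
    suc (3 * s * (t * K) + 3 * (t * K))
      ≡⟨ solve (s ∷ t ∷ K ∷ []) ⟩
    suc (3 * suc s * (t * K))
      ≤⟨ lower ⟩
    2 * F + 3 * suc s * K
      ∎

-- Lifting bounds from one level to the next

AdditiveRecursion : (Vals → ℕ) → Set
AdditiveRecursion f = ∀ p q → f (combine p q) ≡ K q * f p + f q

K'-recursion : AdditiveRecursion K'
K'-recursion p q = cong (_+ K' q) (*-comm (K' p) (K q))

scale-additive-recursion : ∀ c {f} → AdditiveRecursion f → AdditiveRecursion (λ v → c * f v)
scale-additive-recursion c {f} rec p q = trans (cong (c *_) (rec p q)) (distrib c (K q) (f p) (f q))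
  where
  distrib : ∀ c k a b → c * (k * a + b) ≡ k * (c * a) + c * b
  distrib = solve-∀

additive-bound-step : ∀ γ δ fp fq Kp k {fv} → fv ≡ k * fp + fq
  → fp + γ ≤ δ * Kp → fq + γ ≤ γ * k → fv + γ ≤ δ * (Kp * k)
additive-bound-step γ δ fp fq Kp k refl ih-p ih-q = +-cancelʳ-≤ (γ * k) _ _ $ begin
  k * fp + fq + γ + γ * k   ≡⟨ solve (γ ∷ fp ∷ fq ∷ k ∷ []) ⟩
  k * (fp + γ) + (fq + γ)   ≤⟨ *-monoʳ-≤ k ih-p ⊕ ih-q ⟩
  k * (δ * Kp) + γ * k      ≡⟨ cong (_+ γ * k) (solve (δ ∷ Kp ∷ k ∷ [])) ⟩
  δ * (Kp * k) + γ * k      ∎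

lift-additive-bound : ∀ s (f : Vals → ℕ) → AdditiveRecursion f → ∀ γ δ
  → f (base (2 + s)) + γ ≤ δ * K (base (2 + s))
  → (∀ m → 1 ≤ m → f (G (suc s) m) + γ ≤ γ * K (G (suc s) m))
  → ∀ t → 1 ≤ t → f (G (2 + s) t) + γ ≤ δ * K (G (2 + s) t)
lift-additive-bound s f rec γ δ base-bound below = go
  where
  go : ∀ t → 1 ≤ t → f (G (2 + s) t) + γ ≤ δ * K (G (2 + s) t)
  go (suc zero)    _ = base-bound
  go (suc (suc t)) _ =
    additive-bound-step γ δ (f p) (f q) (K p) (K q) (rec p q) (go (suc t) (s≤s z≤n))
      (below (K' p) (K'-positive (invariant (suc s) (suc t) (s≤s z≤n))))
    where
    p = G (2 + s) (suc t)
    q = G (suc s) (K' p)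

Recursion : (f g : Vals → ℕ) → Set
Recursion f g = ∀ p q → f (combine p q) ≡ K q * (f p + g p) + f q

ΔF₂ ΔF₃ : Vals → ℕ
ΔF₂ v = 3 * K' v + 4 * R v + 1
ΔF₃ v = 2 * R v + 3

F₂-recursion : Recursion F2 ΔF₂
F₂-recursion p q =
  cong (λ x → K q * x + F2 q)
       (trans (cong (_+ 1) (+-assoc (F2 p) (3 * K' p) (4 * R p))) (+-assoc (F2 p) (3 * K' p + 4 * R p) 1))

F₃-recursion : Recursion F3 ΔF₃
F₃-recursion p q = cong (λ x → K q * x + F3 q) (+-assoc (F3 p) (2 * R p) 3)

scale-recursion : ∀ c {f g} → Recursion f g → Recursion (λ v → c * f v) (λ v → c * g v)
scale-recursion c {f} {g} rec p q = trans (cong (c *_) (rec p q)) (distrib c (K q) (f p) (g p) (f q))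
  where
  distrib : ∀ c k a b d → c * (k * (a + b) + d) ≡ k * (c * a + c * b) + c * d
  distrib = solve-∀

-- f v ≤ (C − B) · tK, arranged so that for B = 0 it is literally f v ≤ C · tK.
RatioBound : (Vals → ℕ) → (B C t : ℕ) → Vals → Set
RatioBound f B C t v = B * (t * K v) + f v ≤ C * (t * K v)

ratio-bound-step : ∀ B C X Y t fp gp fq Kp m k {fv} → fv ≡ k * (fp + gp) + fq
  → B * (suc t * Kp) + fp ≤ C * (suc t * Kp)
  → B * Kp + (gp + Y * m) ≤ X * m + C * Kp
  → X * (m * k) + fq ≤ Y * (m * k)
  → B * (suc (suc t) * (Kp * k)) + fv ≤ C * (suc (suc t) * (Kp * k))
ratio-bound-step B C X Y t fp gp fq Kp m k refl ih-p increment ih-q =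
  +-cancelʳ-≤ (Y * (m * k) + X * (m * k)) _ _ $ begin
    B * (suc (suc t) * (Kp * k)) + (k * (fp + gp) + fq) + (Y * (m * k) + X * (m * k))
      ≡⟨ solve (B ∷ X ∷ Y ∷ t ∷ fp ∷ gp ∷ fq ∷ Kp ∷ m ∷ k ∷ []) ⟩
    k * (B * (suc t * Kp) + fp) + k * (B * Kp + (gp + Y * m)) + (X * (m * k) + fq)
      ≤⟨ *-monoʳ-≤ k ih-p ⊕ *-monoʳ-≤ k increment ⊕ ih-q ⟩
    k * (C * (suc t * Kp)) + k * (X * m + C * Kp) + Y * (m * k)
      ≡⟨ solve (C ∷ X ∷ Y ∷ t ∷ Kp ∷ m ∷ k ∷ []) ⟩
    C * (suc (suc t) * (Kp * k)) + (Y * (m * k) + X * (m * k))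
      ∎

lift-ratio-bound : ∀ s (f g : Vals → ℕ) → Recursion f g → ∀ B C X Y
  → B * K (base (2 + s)) + f (base (2 + s)) ≤ C * K (base (2 + s))
  → (∀ m → 1 ≤ m → RatioBound f X Y m (G (suc s) m))
  → (∀ t → 1 ≤ t → let v = G (2 + s) t in B * K v + (g v + Y * K' v) ≤ X * K' v + C * K v)
  → ∀ t → 1 ≤ t → RatioBound f B C t (G (2 + s) t)
lift-ratio-bound s f g rec B C X Y base-bound below increment = go
  where
  go : ∀ t → 1 ≤ t → RatioBound f B C t (G (2 + s) t)
  go (suc zero)    _ =
    subst (λ x → B * x + f (base (2 + s)) ≤ C * x) (sym (*-identityˡ (K (base (2 + s))))) base-bound
  go (suc (suc t)) _ =
    ratio-bound-step B C X Y t (f p) (g p) (f q) (K p) (K' p) (K q) (rec p q)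
      (go (suc t) (s≤s z≤n)) (increment (suc t) (s≤s z≤n))
      (below (K' p) (K'-positive (invariant (suc s) (suc t) (s≤s z≤n))))
    where
    p = G (2 + s) (suc t)
    q = G (suc s) (K' p)

-- Levels 1, 2 and 3

K'-bound₁ : ∀ m → 1 ≤ m → K'f 1 m + 5 ≤ 5 * Kf 1 m
K'-bound₁ (suc zero)    _ = ≤-refl
K'-bound₁ (suc (suc m)) _ = ≤-refl

F₂-bound₁ : ∀ m → 1 ≤ m → F₂ 1 m ≤ 14 * (m * Kf 1 m)
F₂-bound₁ (suc zero)    _ = ≤-decide
F₂-bound₁ (suc (suc m)) _ = m+k≡n⇒m≤n (12 * m + 12) slack
  where
  slack : 16 * (2 + m) + 12 + (12 * m + 12) ≡ 14 * ((2 + m) * 2)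
  slack = solve (m ∷ [])

F₃-bound₁ : ∀ m → 1 ≤ m → F₃ 1 m ≤ 6 * (m * Kf 1 m)
F₃-bound₁ (suc zero)    _ = ≤-refl
F₃-bound₁ (suc (suc m)) _ = m+k≡n⇒m≤n (4 * m + 4) slack
  where
  slack : 8 * (2 + m) + 4 + (4 * m + 4) ≡ 6 * ((2 + m) * 2)
  slack = solve (m ∷ [])

K'-bound₂ : ∀ t → 1 ≤ t → K'f 2 t + 5 ≤ 3 * Kf 2 t
K'-bound₂ = lift-additive-bound 0 K' K'-recursion 5 3 ≤-refl K'-bound₁

F₂-increment₂ : ∀ K Y R → Y + 5 ≤ 3 * K → 4 * R ≤ 3 * K → 3 * Y + 4 * R + 1 + 14 * Y ≤ 54 * K
F₂-increment₂ K Y R Y+5≤3K 4R≤3K = +-cancelʳ-≤ 84 _ _ $ begin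
  3 * Y + 4 * R + 1 + 14 * Y + 84  ≡⟨ solve (Y ∷ R ∷ []) ⟩
  17 * (Y + 5) + 4 * R             ≤⟨ *-monoʳ-≤ 17 Y+5≤3K ⊕ 4R≤3K ⟩
  17 * (3 * K) + 3 * K             ≡⟨ solve (K ∷ []) ⟩
  54 * K                           ≤⟨ m≤m+n (54 * K) 84 ⟩
  54 * K + 84                      ∎

F₂-bound₂ : ∀ t → 1 ≤ t → F₂ 2 t ≤ 54 * (t * Kf 2 t)
F₂-bound₂ = lift-ratio-bound 0 F2 ΔF₂ F₂-recursion 0 54 0 14 ≤-decide F₂-bound₁
  (λ t 1≤t → F₂-increment₂ (Kf 2 t) (K'f 2 t) (Rf 2 t)
                (K'-bound₂ t 1≤t) (2^s*R≤3K (invariant 1 t 1≤t)))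

F₃-increment₂ : ∀ K Y R → Y + 5 ≤ 3 * K → R ≤ K → 2 * R + 3 + 6 * Y ≤ 20 * K
F₃-increment₂ K Y R Y+5≤3K R≤K = +-cancelʳ-≤ 27 _ _ $ begin
  2 * R + 3 + 6 * Y + 27  ≡⟨ solve (Y ∷ R ∷ []) ⟩
  6 * (Y + 5) + 2 * R     ≤⟨ *-monoʳ-≤ 6 Y+5≤3K ⊕ *-monoʳ-≤ 2 R≤K ⟩
  6 * (3 * K) + 2 * K     ≡⟨ solve (K ∷ []) ⟩
  20 * K                  ≤⟨ m≤m+n (20 * K) 27 ⟩
  20 * K + 27             ∎

F₃-bound₂ : ∀ t → 1 ≤ t → F₃ 2 t ≤ 20 * (t * Kf 2 t)
F₃-bound₂ = lift-ratio-bound 0 F3 ΔF₃ F₃-recursion 0 20 0 6 ≤-decide F₃-bound₁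
  (λ t 1≤t → F₃-increment₂ (Kf 2 t) (K'f 2 t) (Rf 2 t)
                (K'-bound₂ t 1≤t) (R≤K (invariant 1 t 1≤t)))

K'-bound₃ : ∀ t → 1 ≤ t → 4 * K'f 3 t + 12 ≤ 7 * Kf 3 t
K'-bound₃ =
  lift-additive-bound 1 (λ v → 4 * K' v) (scale-additive-recursion 4 K'-recursion) 12 7 ≤-refl
    (λ m 1≤m → scale (Kf 2 m) (K'f 2 m) (K'-bound₂ m 1≤m))
  where
  scale : ∀ K Y → Y + 5 ≤ 3 * K → 4 * Y + 12 ≤ 12 * K
  scale K Y Y+5≤3K = begin
    4 * Y + 12       ≤⟨ m≤m+n (4 * Y + 12) 8 ⟩
    4 * Y + 12 + 8   ≡⟨ solve (Y ∷ []) ⟩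
    4 * (Y + 5)      ≤⟨ *-monoʳ-≤ 4 Y+5≤3K ⟩
    4 * (3 * K)      ≡⟨ solve (K ∷ []) ⟩
    12 * K           ∎

F₂-increment₃ : ∀ K Y R → 4 * Y + 12 ≤ 7 * K → 8 * R ≤ 3 * K → 3 * Y + 4 * R + 1 + 54 * Y ≤ 102 * K
F₂-increment₃ K Y R K'-bound 8R≤3K = *-cancelˡ-≤ 4 $ +-cancelʳ-≤ 680 _ _ $ begin
  4 * (3 * Y + 4 * R + 1 + 54 * Y) + 680  ≡⟨ solve (Y ∷ R ∷ []) ⟩
  57 * (4 * Y + 12) + 2 * (8 * R)         ≤⟨ *-monoʳ-≤ 57 K'-bound ⊕ *-monoʳ-≤ 2 8R≤3K ⟩
  57 * (7 * K) + 2 * (3 * K)              ≤⟨ m+k≡n⇒m≤n (3 * K + 680) (solve (K ∷ [])) ⟩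
  4 * (102 * K) + 680                     ∎

F₂-bound₃ : ∀ t → 1 ≤ t → F₂ 3 t ≤ 102 * (t * Kf 3 t)
F₂-bound₃ = lift-ratio-bound 1 F2 ΔF₂ F₂-recursion 0 102 0 54 ≤-decide F₂-bound₂
  (λ t 1≤t → F₂-increment₃ (Kf 3 t) (K'f 3 t) (Rf 3 t)
                (K'-bound₃ t 1≤t) (2^s*R≤3K (invariant 2 t 1≤t)))

F₃-increment₃ : ∀ K Y R → 4 * Y + 12 ≤ 7 * K → 8 * R ≤ 3 * K → 2 * R + 3 + 20 * Y ≤ 36 * K
F₃-increment₃ K Y R K'-bound 8R≤3K = *-cancelˡ-≤ 4 $ +-cancelʳ-≤ 228 _ _ $ begin
  4 * (2 * R + 3 + 20 * Y) + 228  ≡⟨ solve (Y ∷ R ∷ []) ⟩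
  20 * (4 * Y + 12) + 8 * R       ≤⟨ *-monoʳ-≤ 20 K'-bound ⊕ 8R≤3K ⟩
  20 * (7 * K) + 3 * K            ≤⟨ m+k≡n⇒m≤n (K + 228) (solve (K ∷ [])) ⟩
  4 * (36 * K) + 228              ∎

F₃-bound₃ : ∀ t → 1 ≤ t → F₃ 3 t ≤ 36 * (t * Kf 3 t)
F₃-bound₃ = lift-ratio-bound 1 F3 ΔF₃ F₃-recursion 0 36 0 20 ≤-decide F₃-bound₂
  (λ t 1≤t → F₃-increment₃ (Kf 3 t) (K'f 3 t) (Rf 3 t)
                (K'-bound₃ t 1≤t) (2^s*R≤3K (invariant 2 t 1≤t)))

-- Levels s ≥ 4

K'+2≤2K : ∀ n t → 1 ≤ t → K'f (3 + n) t + 2 ≤ 2 * Kf (3 + n) t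
K'+2≤2K zero    t 1≤t = halve (Kf 3 t) (K'f 3 t) (K'-bound₃ t 1≤t)
  where
  halve : ∀ K Y → 4 * Y + 12 ≤ 7 * K → Y + 2 ≤ 2 * K
  halve K Y K'-bound = *-cancelˡ-≤ 4 $ begin
    4 * (Y + 2)   ≤⟨ m+k≡n⇒m≤n 4 (solve (Y ∷ [])) ⟩
    4 * Y + 12    ≤⟨ K'-bound ⟩
    7 * K         ≤⟨ *-monoˡ-≤ K {7} {8} ≤-decide ⟩
    8 * K         ≡⟨ solve (K ∷ []) ⟩
    4 * (2 * K)   ∎
K'+2≤2K (suc n) = lift-additive-bound (2 + n) K' K'-recursion 2 2 (base-bound (16≤2^[4+n] n)) (K'+2≤2K n)
  where
  base-bound : ∀ {u} → 16 ≤ u → u + 3 + 2 ≤ 2 * u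
  base-bound {u} 16≤u = begin
    u + 3 + 2  ≡⟨ +-assoc u 3 2 ⟩
    u + 5      ≤⟨ +-monoʳ-≤ u (≤-trans ≤-decide 16≤u) ⟩
    u + u      ≡⟨ solve (u ∷ []) ⟩
    2 * u      ∎

K'-bound≥4 : ∀ n t → 1 ≤ t → let u = 2 ^ (4 + n) in u * K'f (4 + n) t + 2 * u ≤ (u + 5) * Kf (4 + n) t
K'-bound≥4 n =
  lift-additive-bound (2 + n) (λ v → u * K' v) (scale-additive-recursion u K'-recursion) (2 * u) (u + 5)
    (≤-reflexive (base-identity u))
    (λ m 1≤m → scale u (Kf (3 + n) m) (K'f (3 + n) m) (K'+2≤2K n m 1≤m))
  where
  u = 2 ^ (4 + n)
  base-identity : ∀ u → u * (u + 3) + 2 * u ≡ (u + 5) * u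
  base-identity = solve-∀
  scale : ∀ u K Y → Y + 2 ≤ 2 * K → u * Y + 2 * u ≤ 2 * u * K
  scale u K Y K'+2≤2K = begin
    u * Y + 2 * u  ≡⟨ solve (u ∷ Y ∷ []) ⟩
    u * (Y + 2)    ≤⟨ *-monoʳ-≤ u K'+2≤2K ⟩
    u * (2 * K)    ≡⟨ solve (u ∷ K ∷ []) ⟩
    2 * u * K      ∎

plain⇒ratio : ∀ B c C x {F} → B + c ≤ C → F ≤ c * x → B * x + F ≤ C * x
plain⇒ratio B c C x {F} B+c≤C F≤cx = begin
  B * x + F      ≤⟨ +-monoʳ-≤ (B * x) F≤cx ⟩
  B * x + c * x  ≡⟨ sym (*-distribʳ-+ x B c) ⟩
  (B + c) * x    ≤⟨ *-monoˡ-≤ x B+c≤C ⟩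
  C * x          ∎

-- This is where s ≥ 4 is needed: the inequality fails for n = −1.
F₂-numeric : ∀ n → 790 * (3 + n) + 17 ≤ 155 * 2 ^ (4 + n)
F₂-numeric zero    = ≤-decide
F₂-numeric (suc n) = begin
  790 * (4 + n) + 17
    ≡⟨ solve (n ∷ []) ⟩
  790 * (3 + n) + 17 + 790
    ≤⟨ F₂-numeric n ⊕ ≤-trans ≤-decide (*-monoʳ-≤ 155 (16≤2^[4+n] n)) ⟩
  155 * 2 ^ (4 + n) + 155 * 2 ^ (4 + n)
    ≡⟨ double (2 ^ (4 + n)) ⟩
  155 * 2 ^ (5 + n)
    ∎
  where
  double : ∀ x → 155 * x + 155 * x ≡ 155 * (2 * x)
  double = solve-∀

F₂-increment≥4 : ∀ N u K Y R .{{_ : NonZero u}} → 790 * N + 17 ≤ 155 * u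
  → u * Y + 2 * u ≤ (u + 5) * K → u * R ≤ 3 * K
  → 2 * K + (3 * Y + 4 * R + 1 + 158 * N * Y) ≤ 2 * Y + 158 * suc N * K
F₂-increment≥4 N u K Y R N-small K'-bound uR≤3K =
  *-cancelˡ-≤ u $ +-cancelʳ-≤ ((316 * N + 2) * u) _ _ $ begin
  u * (2 * K + (3 * Y + 4 * R + 1 + 158 * N * Y)) + (316 * N + 2) * u
    ≡⟨ solve (N ∷ u ∷ K ∷ Y ∷ R ∷ []) ⟩
  (158 * N + 1) * (u * Y + 2 * u) + 4 * (u * R) + (2 * u * K + u + 2 * u * Y)
    ≤⟨ *-monoʳ-≤ (158 * N + 1) K'-bound ⊕ *-monoʳ-≤ 4 uR≤3K ⊕ ≤-refl ⟩
  (158 * N + 1) * ((u + 5) * K) + 4 * (3 * K) + (2 * u * K + u + 2 * u * Y)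
    ≡⟨ solve (N ∷ u ∷ K ∷ Y ∷ []) ⟩
  (158 * N + 3) * u * K + (790 * N + 17) * K + u + 2 * u * Y
    ≤⟨ +-monoˡ-≤ (2 * u * Y) (+-monoˡ-≤ u (+-monoʳ-≤ _ (*-monoˡ-≤ K N-small))) ⟩
  (158 * N + 3) * u * K + 155 * u * K + u + 2 * u * Y
    ≤⟨ m+k≡n⇒m≤n ((316 * N + 1) * u) (solve (N ∷ u ∷ K ∷ Y ∷ [])) ⟩
  u * (2 * Y + 158 * suc N * K) + (316 * N + 2) * u
    ∎

F₂-base≥4 : ∀ N {u} → 1 ≤ u → 2 * u + (8 * u + 8) ≤ 158 * suc N * u
F₂-base≥4 N {suc w} _ = m+k≡n⇒m≤n (158 * N * suc w + 148 * w + 140) (solve (N ∷ w ∷ []))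

F₂-lift : ∀ n → (∀ m → 1 ≤ m → RatioBound F2 2 (158 * (3 + n)) m (G (3 + n) m))
        → ∀ t → 1 ≤ t → RatioBound F2 2 (158 * (4 + n)) t (G (4 + n) t)
F₂-lift n below =
  lift-ratio-bound (2 + n) F2 ΔF₂ F₂-recursion 2 (158 * (4 + n)) 2 (158 * (3 + n))
    (subst (λ x → 2 * u + x ≤ 158 * (4 + n) * u) (sym (F₂-base (4 + n)))
       (F₂-base≥4 (3 + n) (m^n>0 2 (4 + n))))
    below
    (λ t 1≤t → F₂-increment≥4 (3 + n) u (Kf (4 + n) t) (K'f (4 + n) t) (Rf (4 + n) t) {{m^n≢0 2 (4 + n)}}
                 (F₂-numeric n) (K'-bound≥4 n t 1≤t)
                 (2^s*R≤3K (invariant (3 + n) t 1≤t)))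
  where
  u = 2 ^ (4 + n)

F₂-bound≥4 : ∀ n t → 1 ≤ t → RatioBound F2 2 (158 * (4 + n)) t (G (4 + n) t)
F₂-bound≥4 zero    =
  F₂-lift 0 (λ m 1≤m → plain⇒ratio 2 102 474 (m * Kf 3 m) ≤-decide (F₂-bound₃ m 1≤m))
F₂-bound≥4 (suc n) = F₂-lift (suc n) (F₂-bound≥4 n)

F₃-increment₄ : ∀ K Y R → 16 * Y + 32 ≤ 21 * K → 16 * R ≤ 3 * K
              → 369 * K + (16 * (2 * R + 3) + 576 * Y) ≤ 1152 * K
F₃-increment₄ K Y R K'-bound 16R≤3K = +-cancelʳ-≤ 1104 _ _ $ begin
  369 * K + (16 * (2 * R + 3) + 576 * Y) + 1104
    ≡⟨ solve (K ∷ Y ∷ R ∷ []) ⟩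
  369 * K + 2 * (16 * R) + 36 * (16 * Y + 32)
    ≤⟨ ≤-refl {369 * K} ⊕ *-monoʳ-≤ 2 16R≤3K ⊕ *-monoʳ-≤ 36 K'-bound ⟩
  369 * K + 2 * (3 * K) + 36 * (21 * K)
    ≤⟨ m+k≡n⇒m≤n (21 * K + 1104) (solve (K ∷ [])) ⟩
  1152 * K + 1104
    ∎

F₃-increment≥5 : ∀ u K Y R → u * Y + 2 * u ≤ (u + 5) * K → u * R ≤ 3 * K → K ≤ Y
               → 369 * K + (u * (2 * R + 3) + 72 * u * Y) ≤ 738 * Y + 72 * u * K
F₃-increment≥5 u K Y R K'-bound uR≤3K K≤Y = +-cancelʳ-≤ (141 * u) _ _ $ begin
  369 * K + (u * (2 * R + 3) + 72 * u * Y) + 141 * u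
    ≡⟨ solve (u ∷ K ∷ Y ∷ R ∷ []) ⟩
  72 * (u * Y + 2 * u) + 2 * (u * R) + 369 * K
    ≤⟨ *-monoʳ-≤ 72 K'-bound ⊕ *-monoʳ-≤ 2 uR≤3K ⊕ ≤-refl ⟩
  72 * ((u + 5) * K) + 2 * (3 * K) + 369 * K
    ≡⟨ solve (u ∷ K ∷ []) ⟩
  72 * u * K + 735 * K
    ≤⟨ +-monoʳ-≤ (72 * u * K) (*-monoʳ-≤ 735 K≤Y) ⟩
  72 * u * K + 735 * Y
    ≤⟨ m+k≡n⇒m≤n (3 * Y + 141 * u) (solve (u ∷ K ∷ Y ∷ [])) ⟩
  738 * Y + 72 * u * K + 141 * u
    ∎

F₃-base≥5 : ∀ {u} → 6 ≤ u → 369 * u + u * (4 * u + 4) ≤ 72 * u * u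
F₃-base≥5 {u} 6≤u = begin
  369 * u + u * (4 * u + 4)  ≡⟨ solve (u ∷ []) ⟩
  4 * u * u + 373 * u        ≤⟨ +-monoʳ-≤ (4 * u * u) (*-monoˡ-≤ u {373} {68 * u} 373≤68u) ⟩
  4 * u * u + 68 * u * u     ≡⟨ solve (u ∷ []) ⟩
  72 * u * u                 ∎
  where
  373≤68u : 373 ≤ 68 * u
  373≤68u = ≤-trans ≤-decide (*-monoʳ-≤ 68 6≤u)

F₃-double : ∀ u F x → 369 * x + u * F ≤ 72 * u * x → 738 * x + 2 * u * F ≤ 72 * (2 * u) * x
F₃-double u F x bound = begin
  738 * x + 2 * u * F    ≡⟨ solve (u ∷ F ∷ x ∷ []) ⟩
  2 * (369 * x + u * F)  ≤⟨ *-monoʳ-≤ 2 bound ⟩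
  2 * (72 * u * x)       ≡⟨ solve (u ∷ x ∷ []) ⟩
  72 * (2 * u) * x       ∎

F₃-bound≥4 : ∀ n t → 1 ≤ t
           → RatioBound (λ v → 2 ^ (4 + n) * F3 v) 369 (72 * 2 ^ (4 + n)) t (G (4 + n) t)
F₃-bound≥4 zero =
  lift-ratio-bound 2 (λ v → 16 * F3 v) (λ v → 16 * ΔF₃ v) (scale-recursion 16 F₃-recursion)
    369 1152 0 576 ≤-decide
    (λ m 1≤m → ≤-trans (*-monoʳ-≤ 16 (F₃-bound₃ m 1≤m)) (≤-reflexive (sym (*-assoc 16 36 (m * Kf 3 m)))))
    (λ t 1≤t → F₃-increment₄ (Kf 4 t) (K'f 4 t) (Rf 4 t)
                 (K'-bound≥4 0 t 1≤t) (2^s*R≤3K (invariant 3 t 1≤t)))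
F₃-bound≥4 (suc n) =
  lift-ratio-bound (3 + n) (λ v → u * F3 v) (λ v → u * ΔF₃ v) (scale-recursion u F₃-recursion)
    369 (72 * u) 738 (72 * u)
    (subst (λ x → 369 * u + u * x ≤ 72 * u * u) (sym (F₃-base (5 + n)))
       (F₃-base≥5 (≤-trans ≤-decide (16≤2^[4+n] (suc n)))))
    (λ m 1≤m → F₃-double (2 ^ (4 + n)) (F₃ (4 + n) m) (m * Kf (4 + n) m) (F₃-bound≥4 n m 1≤m))
    (λ t 1≤t → F₃-increment≥5 u (Kf (5 + n) t) (K'f (5 + n) t) (Rf (5 + n) t)
                 (K'-bound≥4 (suc n) t 1≤t) (2^s*R≤3K (invariant (4 + n) t 1≤t)) (K≤K' (4 + n) t 1≤t))
  where
  u = 2 ^ (5 + n)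

tK-positive : ∀ s t → 1 ≤ t → 1 ≤ t * Kf (suc s) t
tK-positive s t 1≤t = *-mono-≤ 1≤t (K-positive (invariant s t 1≤t))

plain-bound⇒< : ∀ c M {F x} → F ≤ c * x → c < M → 1 ≤ x → F < M * x
plain-bound⇒< c M {x = x} F≤cx c<M 1≤x = ≤-<-trans F≤cx (*-monoˡ-< x {{>-nonZero 1≤x}} c<M)

ratio-bound⇒< : ∀ B C {F x} → B * x + F ≤ C * x → 1 ≤ B → 1 ≤ x → F < C * x
ratio-bound⇒< B C {F} {x} bound 1≤B 1≤x = begin-strict
  F          <⟨ m<n+m F (*-mono-≤ 1≤B 1≤x) ⟩
  B * x + F  ≤⟨ bound ⟩
  C * x      ∎

F₃<72tK : ∀ s t → 1 ≤ t → F₃ (suc s) t < 72 * (t * Kf (suc s) t)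
F₃<72tK 0 t 1≤t = plain-bound⇒< 6 72 (F₃-bound₁ t 1≤t) ≤-decide (tK-positive 0 t 1≤t)
F₃<72tK 1 t 1≤t = plain-bound⇒< 20 72 (F₃-bound₂ t 1≤t) ≤-decide (tK-positive 1 t 1≤t)
F₃<72tK 2 t 1≤t = plain-bound⇒< 36 72 (F₃-bound₃ t 1≤t) ≤-decide (tK-positive 2 t 1≤t)
F₃<72tK (suc (suc (suc n))) t 1≤t =
  cancel (2 ^ (4 + n))
    (ratio-bound⇒< 369 (72 * 2 ^ (4 + n)) (F₃-bound≥4 n t 1≤t) ≤-decide (tK-positive (3 + n) t 1≤t))
  where
  cancel : ∀ u {F x} → u * F < 72 * u * x → F < 72 * x
  cancel u {F} {x} scaled = *-cancelˡ-< u F (72 * x) (subst (u * F <_) (reassociate u x) scaled)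
    where
    reassociate : ∀ u x → 72 * u * x ≡ u * (72 * x)
    reassociate = solve-∀

F₂<158s·tK : ∀ s t → 1 ≤ t → F₂ (suc s) t < 158 * suc s * (t * Kf (suc s) t)
F₂<158s·tK 0 t 1≤t = plain-bound⇒< 14 158 (F₂-bound₁ t 1≤t) ≤-decide (tK-positive 0 t 1≤t)
F₂<158s·tK 1 t 1≤t = plain-bound⇒< 54 316 (F₂-bound₂ t 1≤t) ≤-decide (tK-positive 1 t 1≤t)
F₂<158s·tK 2 t 1≤t = plain-bound⇒< 102 474 (F₂-bound₃ t 1≤t) ≤-decide (tK-positive 2 t 1≤t)
F₂<158s·tK (suc (suc (suc n))) t 1≤t =
  ratio-bound⇒< 2 (158 * (4 + n)) (F₂-bound≥4 n t 1≤t) ≤-decide (tK-positive (3 + n) t 1≤t)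

mainTheorem3 : (s t : ℕ) → 1 ≤ s → s < t →
    (t * Kf s t < F₀ s t) × (F₀ s t < F₃ s t) × (F₃ s t < 72 * (t * Kf s t))
    × (3 * s * (t * Kf s t) < 2 * F₁ s t) × (F₁ s t < F₂ s t)
    × (F₂ s t < 158 * s * (t * Kf s t))
mainTheorem3 (suc s) t _ s<t =
  tK<F₀ I , F₀<F₃ I , F₃<72tK s t 1≤t , F₁-lower-bound s t s<t , F₁<F₂ I , F₂<158s·tK s t 1≤t
  where
  1≤t = ≤-trans (s≤s z≤n) s<t
  I = invariant s t 1≤t
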